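{- Let $k\ge 1$ be an integer and $H$ a graph. Then $H$ is an induced subgraph of both $S_k$ and $T_k$ if and only if $H$ is an induced subgraph of $3P_k$ or of $P_{2k+1}+P_{k-1}$.
   Context: All graphs are finite and simple. $S_k$ is the graph obtained from $K_{1,3}$ by replacing each edge by a path of length $k$; $T_k$ is obtained from a triangle $K_3$ by attaching to each of its vertices a new pendant path of length $k$ (length = number of edges). $P_j$ denotes the path on $j$ vertices ($P_0$ empty), $+$ denotes disjoint union, and $3P_k$ is the disjoint union of three copies of $P_k$. -}

module Defs where

open import Data.Nat using (ℕ; zero; suc; _+_; _*_; _∸_; _≡ᵇ_; _<ᵇ_)
open import Data.Bool using (Bool; true; false; _∧_; _∨_; not; if_then_else_)
open import Data.Fin using (Fin; toℕ)
open import Data.Product using (Σ; _×_)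
open import Data.Sum using (_⊎_)
open import Relation.Binary.PropositionalEquality using (_≡_; _≢_)
open import Function.Definitions using (Injective)

-- A finite simple graph on the vertex set Fin n (vertices indexed 0..n-1).
-- 'edge' is a raw edge indicator on vertex indices; adjacency is its
-- symmetric, irreflexive closure.  Every finite simple graph arises this way
-- (take edge = its adjacency), so this models exactly finite simple graphs.
record Graph : Set where
  field
    n    : ℕ
    edge : ℕ → ℕ → Bool
open Graph public

Adj : (G : Graph) → Fin (n G) → Fin (n G) → Set
Adj G i j = (toℕ i ≢ toℕ j) × ((edge G (toℕ i) (toℕ j) ≡ true) ⊎ (edge G (toℕ j) (toℕ i) ≡ true))

_⊑_ : Graph → Graph → Set
H ⊑ G = Σ (Fin (n H) → Fin (n G)) λ f →
          Injective _≡_ _≡_ f ×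
          (∀ i j → (Adj H i j → Adj G (f i) (f j)) × (Adj G (f i) (f j) → Adj H i j))

P : ℕ → Graph
P j = record { n = j ; edge = λ a b → (suc a ≡ᵇ b) ∧ (b <ᵇ j) }

_⊕_ : Graph → Graph → Graph
G ⊕ H = record
  { n = n G + n H
  ; edge = λ a b →
      if (a <ᵇ n G) ∧ (b <ᵇ n G) then edge G a b
      else (if not (a <ᵇ n G) ∧ not (b <ᵇ n G) then edge H (a ∸ n G) (b ∸ n G) else false)
  }
infixr 5 _⊕_

3P : ℕ → Graph
3P k = P k ⊕ P k ⊕ P k

-- S_k: three paths of k vertices (starting at 0, k, 2k) plus a centre 3k
-- adjacent to the first vertex of each path; i.e. K_{1,3} with each edge
-- subdivided into a path of length k.
S : ℕ → Graph
S k = record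
  { n = 3 * k + 1
  ; edge = λ a b → edge (3P k) a b ∨
      ((b ≡ᵇ 3 * k) ∧ ((a ≡ᵇ 0) ∨ (a ≡ᵇ k) ∨ (a ≡ᵇ 2 * k)))
  }

-- T_k: three paths of k+1 vertices (starting at 0, k+1, 2(k+1)); the
-- starting vertices form a triangle, each carrying a pendant path of length k.
T : ℕ → Graph
T k = record
  { n = 3 * suc k
  ; edge = λ a b → edge (3P (suc k)) a b ∨ (tri a ∧ tri b)
  }
  where
  tri : ℕ → Bool
  tri x = (x ≡ᵇ 0) ∨ (x ≡ᵇ suc k) ∨ (x ≡ᵇ 2 * suc k)

-- Name the vertices of all graphs involved by points of a spider: the centre, or the r-th vertex of
-- leg ℓ. Then 3P_k is S_k without its centre, P_{2k+1} + P_{k-1} is S_k without a neighbour of the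
-- centre, and both are also induced subgraphs of T_k (shift every leg outwards, resp. run the long
-- path through an edge of the triangle). Conversely, if H embeds in S_k with the centre and all its
-- neighbours in the image, those four vertices induce a claw in H; but T_k is claw-free, since the
-- neighbours of any vertex other than the next one along its leg are pairwise adjacent.

module Submission where

open import Defs
open import Data.Nat using (ℕ; zero; suc; _+_; _*_; _∸_; _≤_; _<_; _≡ᵇ_; _<ᵇ_; z≤n; s≤s; s<s⁻¹; _<?_; _≟_)
open import Data.Nat.Properties
open import Data.Bool using (Bool; true; false; _∧_; _∨_) renaming (T to IsTrue)
open import Data.Bool.Properties using (T-≡; T-∧; T-∨)
open import Data.Product.Function.NonDependent.Propositional using (_×-⇔_)
open import Data.Sum.Function.Propositional using (_⊎-⇔_)
open import Function.Properties.Equivalence using () renaming (refl to ⇔-refl; sym to ⇔-sym; trans to ⇔-trans)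
open import Data.Fin using (Fin; toℕ; fromℕ<) renaming (zero to fz; suc to fs)
open import Data.Fin.Properties using (toℕ<n; toℕ-fromℕ<; toℕ-injective; any?; all?; ¬∀⟶∃¬) renaming (_≟_ to _≟ᶠ_)
open import Data.Product using (Σ; _×_; _,_; proj₁; proj₂)
open import Data.Sum using (_⊎_; inj₁; inj₂)
open import Data.Empty using (⊥; ⊥-elim)
open import Data.Unit using (⊤; tt)
open import Relation.Nullary using (¬_; yes; no; Dec)
open import Relation.Nullary.Decidable using (map′; _×-dec_)
open import Relation.Binary.PropositionalEquality
open import Relation.Binary.Construct.Union using (_∪_)
open import Relation.Unary using (_∩_)
open import Relation.Binary.Construct.Closure.Symmetric using (SymClosure; fwd; bwd; symmetric; gmap)
open import Function.Bundles using (_⇔_; mk⇔; Equivalence)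
open import Data.Fin.Permutation.Components using (transpose; transpose-inverse)

open Equivalence using (to; from)

∧≡true⇔ : ∀ {a b} → (a ∧ b ≡ true) ⇔ (a ≡ true × b ≡ true)
∧≡true⇔ = ⇔-trans (⇔-sym T-≡) (⇔-trans T-∧ (T-≡ ×-⇔ T-≡))

∨≡true⇔ : ∀ {a b} → (a ∨ b ≡ true) ⇔ (a ≡ true ⊎ b ≡ true)
∨≡true⇔ = ⇔-trans (⇔-sym T-≡) (⇔-trans T-∨ (T-≡ ⊎-⇔ T-≡))

<⇒<ᵇ≡true : ∀ {m n} → m < n → (m <ᵇ n) ≡ true
<⇒<ᵇ≡true m<n = to T-≡ (<⇒<ᵇ m<n)

<ᵇ≡true⇒< : ∀ {m n} → (m <ᵇ n) ≡ true → m < n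
<ᵇ≡true⇒< {m} {n} e = <ᵇ⇒< m n (from T-≡ e)

≤⇒<ᵇ≡false : ∀ {m n} → n ≤ m → (m <ᵇ n) ≡ false
≤⇒<ᵇ≡false {m} {n} n≤m with m <ᵇ n in e
... | false = refl
... | true = ⊥-elim (<⇒≱ (<ᵇ≡true⇒< e) n≤m)

<ᵇ≡false⇒≤ : ∀ {m n} → (m <ᵇ n) ≡ false → n ≤ m
<ᵇ≡false⇒≤ {m} {n} e = ≮⇒≥ λ m<n → subst IsTrue e (<⇒<ᵇ m<n)

≡⇒≡ᵇ≡true : ∀ {m n} → m ≡ n → (m ≡ᵇ n) ≡ true
≡⇒≡ᵇ≡true {m} {n} m≡n = to T-≡ (≡⇒≡ᵇ m n m≡n)

≡ᵇ≡true⇒≡ : ∀ {m n} → (m ≡ᵇ n) ≡ true → m ≡ n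
≡ᵇ≡true⇒≡ {m} {n} e = ≡ᵇ⇒≡ m n (from T-≡ e)

edge-P : ∀ {j a b} → edge (P j) a b ≡ true ⇔ (suc a ≡ b × b < j)
edge-P {j} {a} {b} = mk⇔ split join
  where
  split : edge (P j) a b ≡ true → suc a ≡ b × b < j
  split e with to ∧≡true⇔ e
  ... | e₁ , e₂ = ≡ᵇ≡true⇒≡ e₁ , <ᵇ≡true⇒< e₂
  join : suc a ≡ b × b < j → edge (P j) a b ≡ true
  join (refl , b<j) rewrite ≡⇒≡ᵇ≡true {b} refl | <⇒<ᵇ≡true b<j = refl

EdgeOf⊕ : Graph → Graph → ℕ → ℕ → Set
EdgeOf⊕ G H a b =
  (a < n G × b < n G × edge G a b ≡ true) ⊎
  Σ ℕ λ a′ → Σ ℕ λ b′ → a ≡ n G + a′ × b ≡ n G + b′ × edge H a′ b′ ≡ true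

edge-⊕ : ∀ {G H a b} → edge (G ⊕ H) a b ≡ true ⇔ EdgeOf⊕ G H a b
edge-⊕ {G} {H} {a} {b} = mk⇔ split join
  where
  split : edge (G ⊕ H) a b ≡ true → EdgeOf⊕ G H a b
  split e with a <ᵇ n G in ea | b <ᵇ n G in eb
  ... | true | true = inj₁ (<ᵇ≡true⇒< ea , <ᵇ≡true⇒< eb , e)
  ... | false | false = inj₂ (a ∸ n G , b ∸ n G ,
          sym (m+[n∸m]≡n (<ᵇ≡false⇒≤ {a} {n G} ea)) , sym (m+[n∸m]≡n (<ᵇ≡false⇒≤ {b} {n G} eb)) , e)
  join : EdgeOf⊕ G H a b → edge (G ⊕ H) a b ≡ true
  join (inj₁ (a< , b< , e)) rewrite <⇒<ᵇ≡true a< | <⇒<ᵇ≡true b< = e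
  join (inj₂ (a′ , b′ , refl , refl , e))
    rewrite ≤⇒<ᵇ≡false (m≤m+n (n G) a′) | ≤⇒<ᵇ≡false (m≤m+n (n G) b′)
          | m+n∸m≡n (n G) a′ | m+n∸m≡n (n G) b′ = e

-- Spider coordinates

data Coord : Set where
  centre : Coord
  leg    : Fin 3 → ℕ → Coord

pattern ℓ₀ = fz
pattern ℓ₁ = fs fz
pattern ℓ₂ = fs (fs fz)

data Step : Coord → Coord → Set where
  step : ∀ ℓ r → Step (leg ℓ r) (leg ℓ (suc r))

data Hub : Coord → Coord → Set where
  hub : ∀ ℓ → Hub (leg ℓ 0) centre

data Triangle : Coord → Coord → Set where
  triangle : ∀ {ℓ ℓ′} → ℓ ≢ ℓ′ → Triangle (leg ℓ 0) (leg ℓ′ 0)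

ArcS ArcT AdjS AdjT : Coord → Coord → Set
ArcS = Step ∪ Hub
ArcT = Step ∪ Triangle
AdjS = SymClosure ArcS
AdjT = SymClosure ArcT

ArcS-irreflexive : ∀ {x} → ¬ ArcS x x
ArcS-irreflexive (inj₁ ())
ArcS-irreflexive (inj₂ ())

ArcT-irreflexive : ∀ {x} → ¬ ArcT x x
ArcT-irreflexive (inj₁ ())
ArcT-irreflexive (inj₂ (triangle ℓ≢ℓ)) = ℓ≢ℓ refl

_≟ᶜ_ : (x y : Coord) → Dec (x ≡ y)
centre  ≟ᶜ centre    = yes refl
centre  ≟ᶜ leg _ _   = no λ ()
leg _ _ ≟ᶜ centre    = no λ ()
leg ℓ r ≟ᶜ leg ℓ′ r′ =
  map′ (λ { (refl , refl) → refl }) (λ { refl → refl , refl }) ((ℓ ≟ᶠ ℓ′) ×-dec (r ≟ r′))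

OnLegs : ℕ → Coord → Set
OnLegs m centre    = ⊥
OnLegs m (leg _ r) = r < m

InSpider : ℕ → Coord → Set
InSpider m centre    = ⊤
InSpider m (leg _ r) = r < m

onLegs⇒inSpider : ∀ {m x} → OnLegs m x → InSpider m x
onLegs⇒inSpider {x = leg _ _} r<m = r<m

IsLegStart : Coord → Set
IsLegStart x = Σ (Fin 3) λ ℓ → x ≡ leg ℓ 0

Hub⇔ : ∀ {x y} → Hub x y ⇔ (y ≡ centre × IsLegStart x)
Hub⇔ = mk⇔ split join
  where
  split : ∀ {x y} → Hub x y → y ≡ centre × IsLegStart x
  split (hub ℓ) = refl , ℓ , refl
  join : ∀ {x y} → y ≡ centre × IsLegStart x → Hub x y
  join (refl , ℓ , refl) = hub ℓ

Triangle⇔ : ∀ {x y} → x ≢ y → Triangle x y ⇔ (IsLegStart x × IsLegStart y)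
Triangle⇔ x≢y = mk⇔ split (join x≢y)
  where
  split : ∀ {x y} → Triangle x y → IsLegStart x × IsLegStart y
  split (triangle {ℓ} {ℓ′} _) = (ℓ , refl) , (ℓ′ , refl)
  join : ∀ {x y} → x ≢ y → IsLegStart x × IsLegStart y → Triangle x y
  join x≢y ((ℓ , refl) , (ℓ′ , refl)) = triangle (λ ℓ≡ℓ′ → x≢y (cong (λ ℓ → leg ℓ 0) ℓ≡ℓ′))

AdjN : Graph → ℕ → ℕ → Set
AdjN G a b = a ≢ b × (edge G a b ≡ true ⊎ edge G b a ≡ true)

adjacency-from-arcs : ∀ {G} {V : Coord → Set} {pos : Coord → ℕ} {Arc : Coord → Coord → Set} →
  (∀ {x y} → V x → V y → pos x ≡ pos y → x ≡ y) →
  (∀ {x} → ¬ Arc x x) →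
  (∀ {x y} → V x → V y → x ≢ y → edge G (pos x) (pos y) ≡ true ⇔ Arc x y) →
  ∀ {x y} → V x → V y → AdjN G (pos x) (pos y) ⇔ SymClosure Arc x y
adjacency-from-arcs {G} {V} {pos} {Arc} pos-injective irreflexive edge⇔arc vx vy =
  mk⇔ (split vx vy) (join vx vy)
  where
  split : ∀ {x y} → V x → V y → AdjN G (pos x) (pos y) → SymClosure Arc x y
  split vx vy (pos≢ , inj₁ e) = fwd (to (edge⇔arc vx vy (λ x≡y → pos≢ (cong pos x≡y))) e)
  split vx vy (pos≢ , inj₂ e) = bwd (to (edge⇔arc vy vx (λ y≡x → pos≢ (cong pos (sym y≡x)))) e)
  arc⇒≢ : ∀ {x y} → Arc x y → x ≢ y
  arc⇒≢ a refl = irreflexive a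
  join : ∀ {x y} → V x → V y → SymClosure Arc x y → AdjN G (pos x) (pos y)
  join vx vy (fwd a) =
    (λ e → arc⇒≢ a (pos-injective vx vy e)) , inj₁ (from (edge⇔arc vx vy (arc⇒≢ a)) a)
  join vx vy (bwd a) =
    (λ e → arc⇒≢ a (pos-injective vy vx (sym e))) , inj₂ (from (edge⇔arc vy vx (arc⇒≢ a)) a)

record Model (G : Graph) : Set₁ where
  field
    Vertex              : Coord → Set
    Adjacent            : Coord → Coord → Set
    position            : Coord → ℕ
    position<           : ∀ {x} → Vertex x → position x < n G
    position-injective  : ∀ {x y} → Vertex x → Vertex y → position x ≡ position y → x ≡ y
    position-surjective : ∀ {a} → a < n G → Σ Coord λ x → Vertex x × position x ≡ a
    adjacent⇔           : ∀ {x y} → Vertex x → Vertex y → AdjN G (position x) (position y) ⇔ Adjacent x y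

record CoordEmbedding (H : Graph) (V : Coord → Set) (R : Coord → Coord → Set) : Set where
  field
    coord           : Fin (n H) → Coord
    coord-valid     : ∀ i → V (coord i)
    coord-injective : ∀ {i j} → coord i ≡ coord j → i ≡ j
    adj⇔            : ∀ i j → Adj H i j ⇔ R (coord i) (coord j)

module _ {G : Graph} (M : Model G) where
  open Model M

  ⊑⇒coordEmbedding : ∀ {H} → H ⊑ G → CoordEmbedding H Vertex Adjacent
  ⊑⇒coordEmbedding {H} (f , f-injective , f-adj) = record
    { coord           = coord
    ; coord-valid     = valid
    ; coord-injective = λ {i} {j} e →
        f-injective (toℕ-injective (trans (sym (position-coord i)) (trans (cong position e) (position-coord j))))
    ; adj⇔ = λ i j → ⇔-trans (mk⇔ (proj₁ (f-adj i j)) (proj₂ (f-adj i j)))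
                     (⇔-trans (AdjN-resp (position-coord i) (position-coord j)) (adjacent⇔ (valid i) (valid j)))
    }
    where
    located : ∀ i → Σ Coord λ x → Vertex x × position x ≡ toℕ (f i)
    located i = position-surjective (toℕ<n (f i))
    coord : Fin (n H) → Coord
    coord i = proj₁ (located i)
    valid : ∀ i → Vertex (coord i)
    valid i = proj₁ (proj₂ (located i))
    position-coord : ∀ i → position (coord i) ≡ toℕ (f i)
    position-coord i = proj₂ (proj₂ (located i))
    AdjN-resp : ∀ {a a′ b b′} → a ≡ a′ → b ≡ b′ → AdjN G a′ b′ ⇔ AdjN G a b
    AdjN-resp refl refl = ⇔-refl

  coordEmbedding⇒⊑ : ∀ {H} → CoordEmbedding H Vertex Adjacent → H ⊑ G
  coordEmbedding⇒⊑ {H} e = f , f-injective , λ i j → to (adj⇔′ i j) , from (adj⇔′ i j)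
    where
    open CoordEmbedding e
    f : Fin (n H) → Fin (n G)
    f i = fromℕ< (position< (coord-valid i))
    toℕ-f : ∀ i → toℕ (f i) ≡ position (coord i)
    toℕ-f i = toℕ-fromℕ< (position< (coord-valid i))
    f-injective : ∀ {i j} → f i ≡ f j → i ≡ j
    f-injective {i} {j} e = coord-injective (position-injective (coord-valid i) (coord-valid j)
      (trans (sym (toℕ-f i)) (trans (cong toℕ e) (toℕ-f j))))
    adj⇔′ : ∀ i j → Adj H i j ⇔ Adj G (f i) (f j)
    adj⇔′ i j rewrite toℕ-f i | toℕ-f j =
      ⇔-trans (adj⇔ i j) (⇔-sym (adjacent⇔ (coord-valid i) (coord-valid j)))

remap : ∀ {H} {V V′ : Coord → Set} {R R′ : Coord → Coord → Set} (σ : Coord → Coord) →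
  (∀ {x} → V x → V′ (σ x)) →
  (∀ {x y} → V x → V y → σ x ≡ σ y → x ≡ y) →
  (∀ {x y} → V x → V y → R x y ⇔ R′ (σ x) (σ y)) →
  CoordEmbedding H V R → CoordEmbedding H V′ R′
remap σ σ-valid σ-injective σ-adj e = record
  { coord           = λ i → σ (coord i)
  ; coord-valid     = λ i → σ-valid (coord-valid i)
  ; coord-injective = λ {i} {j} eq → coord-injective (σ-injective (coord-valid i) (coord-valid j) eq)
  ; adj⇔            = λ i j → ⇔-trans (adj⇔ i j) (σ-adj (coord-valid i) (coord-valid j))
  }
  where open CoordEmbedding e

restrict : ∀ {H} {V Q : Coord → Set} {R : Coord → Coord → Set} (e : CoordEmbedding H V R) →
  (∀ i → Q (CoordEmbedding.coord e i)) → CoordEmbedding H (V ∩ Q) R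
restrict e q = record
  { coord = coord ; coord-valid = λ i → coord-valid i , q i
  ; coord-injective = coord-injective ; adj⇔ = adj⇔ }
  where open CoordEmbedding e

relax : ∀ {H} {V V′ : Coord → Set} {R : Coord → Coord → Set} →
  (∀ {x} → V x → V′ x) → CoordEmbedding H V R → CoordEmbedding H V′ R
relax V⇒V′ = remap (λ x → x) V⇒V′ (λ _ _ e → e) (λ _ _ → ⇔-refl)

-- q * m + r, written so that it reduces to the sums m + (m + r) occurring in Defs.
blocks : ℕ → ℕ → ℕ → ℕ
blocks m zero    r = r
blocks m (suc q) r = m + blocks m q r

blocks-injective : ∀ m {q q′ r r′} → r < m → r′ < m →
  blocks m q r ≡ blocks m q′ r′ → q ≡ q′ × r ≡ r′
blocks-injective m {zero} {zero} _ _ e = refl , e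
blocks-injective m {zero} {suc q′} {r′ = r′} r<m _ refl = ⊥-elim (m+n≮m m (blocks m q′ r′) r<m)
blocks-injective m {suc q} {zero} {r} _ r′<m refl = ⊥-elim (m+n≮m m (blocks m q r) r′<m)
blocks-injective m {suc q} {suc q′} r<m r′<m e
  with blocks-injective m {q} {q′} r<m r′<m (+-cancelˡ-≡ m _ _ e)
... | refl , r≡r′ = refl , r≡r′

blocks-surjective : ∀ m q {a} → a < blocks m q 0 →
  Σ ℕ λ p → Σ ℕ λ r → p < q × r < m × blocks m p r ≡ a
blocks-surjective m zero ()
blocks-surjective m (suc q) {a} a< with a <? m
... | yes a<m = 0 , a , s≤s z≤n , a<m , refl
... | no a≮m =
  let p , r , p<q , r<m , e = blocks-surjective m q a∸m<
  in suc p , r , s≤s p<q , r<m , trans (cong (m +_) e) m+[a∸m]≡a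
  where
  m+[a∸m]≡a : m + (a ∸ m) ≡ a
  m+[a∸m]≡a = m+[n∸m]≡n (≮⇒≥ a≮m)
  a∸m< : a ∸ m < blocks m q 0
  a∸m< = +-cancelˡ-< m _ _ (subst (_< m + blocks m q 0) (sym m+[a∸m]≡a) a<)

blocks-< : ∀ m {p q r} → p < q → r < m → blocks m p r < blocks m q 0
blocks-< m {zero} {suc q} _ r<m = ≤-trans r<m (m≤m+n m _)
blocks-< m {suc p} {suc q} p<q r<m = +-monoʳ-< m (blocks-< m (s<s⁻¹ p<q) r<m)

block : Coord → ℕ
block centre    = 3
block (leg ℓ _) = toℕ ℓ

offset : Coord → ℕ
offset centre    = 0
offset (leg _ r) = r

-- The numbering of S and T in Defs: leg ℓ occupies [ℓ m, (ℓ + 1) m) and the centre is 3 m.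
index : ℕ → Coord → ℕ
index m x = blocks m (block x) (offset x)

offset< : ∀ {m} → 0 < m → ∀ x → InSpider m x → offset x < m
offset< 0<m centre    _   = 0<m
offset< _   (leg _ _) r<m = r<m

blockOffset-injective : ∀ {x y} → block x ≡ block y → offset x ≡ offset y → x ≡ y
blockOffset-injective {centre}  {centre}  _ _ = refl
blockOffset-injective {centre}  {leg ℓ _} e _ = ⊥-elim (<⇒≢ (toℕ<n ℓ) (sym e))
blockOffset-injective {leg ℓ _} {centre}  e _ = ⊥-elim (<⇒≢ (toℕ<n ℓ) e)
blockOffset-injective {leg ℓ r} {leg ℓ′ r′} e refl = cong (λ ℓ → leg ℓ r) (toℕ-injective e)

index-injective : ∀ {m} → 0 < m → ∀ {x y} → InSpider m x → InSpider m y →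
  index m x ≡ index m y → x ≡ y
index-injective 0<m {x} {y} vx vy e =
  let block≡ , offset≡ = blocks-injective _ (offset< 0<m x vx) (offset< 0<m y vy) e
  in blockOffset-injective block≡ offset≡

index<3m : ∀ {m} x → OnLegs m x → index m x < 3 * m
index<3m {m} (leg ℓ r) r<m = blocks-< m (toℕ<n ℓ) r<m

index-onto-legs : ∀ m {a} → a < 3 * m → Σ Coord λ x → OnLegs m x × index m x ≡ a
index-onto-legs m a<3m =
  let p , r , p<3 , r<m , e = blocks-surjective m 3 a<3m
  in leg (fromℕ< p<3) r , r<m , trans (cong (λ q → blocks m q r) (toℕ-fromℕ< p<3)) e

LegEdge : ℕ → ℕ → ℕ → Set
LegEdge m a b = Σ (Fin 3) λ ℓ → Σ ℕ λ r →
  suc r < m × a ≡ index m (leg ℓ r) × b ≡ index m (leg ℓ (suc r))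

edge-3P : ∀ {m a b} → edge (3P m) a b ≡ true ⇔ LegEdge m a b
edge-3P {m} = mk⇔ split join
  where
  pathEdge : ∀ {a b} → edge (P m) a b ≡ true → Σ ℕ λ r → suc r < m × a ≡ r × b ≡ suc r
  pathEdge {a} e with to (edge-P {m} {a}) e
  ... | refl , b<m = a , b<m , refl , refl

  split : ∀ {a b} → edge (3P m) a b ≡ true → LegEdge m a b
  split e with to (edge-⊕ {P m} {P m ⊕ P m}) e
  ... | inj₁ (_ , _ , e₀) =
    let r , l , ea , eb = pathEdge e₀ in ℓ₀ , r , l , ea , eb
  ... | inj₂ (_ , _ , refl , refl , e′) with to (edge-⊕ {P m} {P m}) e′
  ...   | inj₁ (_ , _ , e₁) =
    let r , l , ea , eb = pathEdge e₁ in ℓ₁ , r , l , cong (m +_) ea , cong (m +_) eb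
  ...   | inj₂ (_ , _ , refl , refl , e₂) =
    let r , l , ea , eb = pathEdge e₂ in ℓ₂ , r , l , cong (λ c → m + (m + c)) ea , cong (λ c → m + (m + c)) eb

  join : ∀ {a b} → LegEdge m a b → edge (3P m) a b ≡ true
  join (ℓ , r , l , refl , refl) = joinLeg ℓ
    where
    e : edge (P m) r (suc r) ≡ true
    e = from edge-P (refl , l)
    joinPath : ∀ {H} → edge (P m ⊕ H) r (suc r) ≡ true
    joinPath {H} = from (edge-⊕ {P m} {H}) (inj₁ (<⇒≤ l , l , e))
    joinLeg : ∀ ℓ → edge (3P m) (index m (leg ℓ r)) (index m (leg ℓ (suc r))) ≡ true
    joinLeg ℓ₀ = joinPath {P m ⊕ P m}
    joinLeg ℓ₁ = from (edge-⊕ {P m} {P m ⊕ P m}) (inj₂ (r , suc r , refl , refl , joinPath {P m}))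
    joinLeg ℓ₂ = from (edge-⊕ {P m} {P m ⊕ P m}) (inj₂ (m + r , m + suc r , refl , refl ,
                   from (edge-⊕ {P m} {P m}) (inj₂ (r , suc r , refl , refl , e))))

edge-3P⇔Step : ∀ {m} → 0 < m → ∀ {x y} → InSpider m x → InSpider m y →
  edge (3P m) (index m x) (index m y) ≡ true ⇔ Step x y
edge-3P⇔Step {m} 0<m vx vy = mk⇔ (split vx vy) (join vy)
  where
  split : ∀ {x y} → InSpider m x → InSpider m y → edge (3P m) (index m x) (index m y) ≡ true → Step x y
  split {x} {y} vx vy e with to edge-3P e
  ... | ℓ , r , l , ex , ey
    with index-injective 0<m {y = leg ℓ r} vx (<⇒≤ l) ex | index-injective 0<m {y = leg ℓ (suc r)} vy l ey
  ... | refl | refl = step ℓ r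
  join : ∀ {x y} → InSpider m y → Step x y → edge (3P m) (index m x) (index m y) ≡ true
  join vy (step ℓ r) = from edge-3P (ℓ , r , vy , refl , refl)

-- The test by which Defs recognises the first vertices of the legs in S and T.
isLegStart : ℕ → ℕ → Bool
isLegStart m a = (a ≡ᵇ 0) ∨ (a ≡ᵇ m) ∨ (a ≡ᵇ 2 * m)

isLegStart⇔ : ∀ {m a} → isLegStart m a ≡ true ⇔ (Σ (Fin 3) λ ℓ → a ≡ index m (leg ℓ 0))
isLegStart⇔ {m} {a} = mk⇔ split join
  where
  split : isLegStart m a ≡ true → Σ (Fin 3) λ ℓ → a ≡ index m (leg ℓ 0)
  split e with to ∨≡true⇔ e
  ... | inj₁ e₀ = ℓ₀ , ≡ᵇ≡true⇒≡ e₀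
  ... | inj₂ e′ with to ∨≡true⇔ e′
  ...   | inj₁ e₁ = ℓ₁ , trans (≡ᵇ≡true⇒≡ e₁) (sym (+-identityʳ m))
  ...   | inj₂ e₂ = ℓ₂ , ≡ᵇ≡true⇒≡ e₂
  join : (Σ (Fin 3) λ ℓ → a ≡ index m (leg ℓ 0)) → isLegStart m a ≡ true
  join (ℓ₀ , e) = from ∨≡true⇔ (inj₁ (≡⇒≡ᵇ≡true e))
  join (ℓ₁ , e) =
    from (∨≡true⇔ {a ≡ᵇ 0}) (inj₂ (from ∨≡true⇔ (inj₁ (≡⇒≡ᵇ≡true (trans e (+-identityʳ m))))))
  join (ℓ₂ , e) =
    from (∨≡true⇔ {a ≡ᵇ 0}) (inj₂ (from (∨≡true⇔ {a ≡ᵇ m}) (inj₂ (≡⇒≡ᵇ≡true e))))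

isLegStart-index⇔ : ∀ {m} → 0 < m → ∀ {x} → InSpider m x →
  isLegStart m (index m x) ≡ true ⇔ IsLegStart x
isLegStart-index⇔ {m} 0<m {x} vx = mk⇔ split join
  where
  split : isLegStart m (index m x) ≡ true → IsLegStart x
  split e = let ℓ , eℓ = to isLegStart⇔ e in ℓ , index-injective 0<m vx 0<m eℓ
  join : IsLegStart x → isLegStart m (index m x) ≡ true
  join (ℓ , refl) = from isLegStart⇔ (ℓ , refl)

isCentre-index⇔ : ∀ {m} → 0 < m → ∀ {y} → InSpider m y →
  (index m y ≡ᵇ 3 * m) ≡ true ⇔ y ≡ centre
isCentre-index⇔ {m} 0<m vy =
  mk⇔ (λ e → index-injective 0<m vy tt (≡ᵇ≡true⇒≡ e)) (λ { refl → ≡⇒≡ᵇ≡true {3 * m} refl })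

edge-S⇔ : ∀ {k} → 0 < k → ∀ {x y} → InSpider k x → InSpider k y →
  edge (S k) (index k x) (index k y) ≡ true ⇔ (Step ∪ Hub) x y
edge-S⇔ 0<k vx vy = ⇔-trans ∨≡true⇔ (edge-3P⇔Step 0<k vx vy ⊎-⇔
  ⇔-trans ∧≡true⇔ (⇔-trans (isCentre-index⇔ 0<k vy ×-⇔ isLegStart-index⇔ 0<k vx) (⇔-sym Hub⇔)))

edge-T⇔ : ∀ {k x y} → OnLegs (suc k) x → OnLegs (suc k) y → x ≢ y →
  edge (T k) (index (suc k) x) (index (suc k) y) ≡ true ⇔ (Step ∪ Triangle) x y
edge-T⇔ {k} vx vy x≢y = ⇔-trans ∨≡true⇔ (edge-3P⇔Step 0<m sx sy ⊎-⇔
  ⇔-trans ∧≡true⇔ (⇔-trans (isLegStart-index⇔ 0<m sx ×-⇔ isLegStart-index⇔ 0<m sy)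
                           (⇔-sym (Triangle⇔ x≢y))))
  where
  0<m : 0 < suc k
  0<m = s≤s z≤n
  sx = onLegs⇒inSpider vx
  sy = onLegs⇒inSpider vy

Step⇔ArcS : ∀ {m x y} → OnLegs m y → Step x y ⇔ ArcS x y
Step⇔ArcS {y = leg _ _} _ = mk⇔ inj₁ λ { (inj₁ s) → s ; (inj₂ ()) }

3*m≡n[3P] : ∀ m → 3 * m ≡ n (3P m)
3*m≡n[3P] m = cong (λ c → m + (m + c)) (+-identityʳ m)

model3P : ∀ m → 0 < m → Model (3P m)
model3P m 0<m = record
  { Vertex = OnLegs m ; Adjacent = AdjS ; position = index m
  ; position<           = λ {x} vx → subst (index m x <_) (3*m≡n[3P] m) (index<3m x vx)
  ; position-injective  = injective
  ; position-surjective = λ {a} a< → index-onto-legs m (subst (a <_) (sym (3*m≡n[3P] m)) a<)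
  ; adjacent⇔ = adjacency-from-arcs {3P m} {pos = index m} injective ArcS-irreflexive
      (λ vx vy _ → ⇔-trans (edge-3P⇔Step 0<m (onLegs⇒inSpider vx) (onLegs⇒inSpider vy)) (Step⇔ArcS vy))
  }
  where
  injective : ∀ {x y} → OnLegs m x → OnLegs m y → index m x ≡ index m y → x ≡ y
  injective vx vy = index-injective 0<m (onLegs⇒inSpider vx) (onLegs⇒inSpider vy)

modelS : ∀ k → 0 < k → Model (S k)
modelS k 0<k = record
  { Vertex = InSpider k ; Adjacent = AdjS ; position = index k
  ; position<           = position<
  ; position-injective  = index-injective 0<k
  ; position-surjective = surjective
  ; adjacent⇔ = adjacency-from-arcs {S k} {pos = index k} (index-injective 0<k) ArcS-irreflexive
      (λ vx vy _ → edge-S⇔ 0<k vx vy)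
  }
  where
  position< : ∀ {x} → InSpider k x → index k x < 3 * k + 1
  position< {centre}  _  = m<m+n (3 * k) (s≤s z≤n)
  position< {leg ℓ r} vx = ≤-trans (index<3m (leg ℓ r) vx) (m≤m+n (3 * k) 1)
  surjective : ∀ {a} → a < 3 * k + 1 → Σ Coord λ x → InSpider k x × index k x ≡ a
  surjective {a} a< with a <? 3 * k
  ... | yes a<3k = let x , vx , e = index-onto-legs k a<3k in x , onLegs⇒inSpider {x = x} vx , e
  ... | no a≮3k = centre , tt , ≤-antisym (≮⇒≥ a≮3k) (m<1+n⇒m≤n (subst (a <_) (+-comm (3 * k) 1) a<))

modelT : ∀ k → Model (T k)
modelT k = record
  { Vertex = OnLegs (suc k) ; Adjacent = AdjT ; position = index (suc k)
  ; position<           = λ {x} → index<3m x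
  ; position-injective  = injective
  ; position-surjective = index-onto-legs (suc k)
  ; adjacent⇔ = adjacency-from-arcs {T k} {pos = index (suc k)} injective ArcT-irreflexive edge-T⇔
  }
  where
  injective : ∀ {x y} → OnLegs (suc k) x → OnLegs (suc k) y → index (suc k) x ≡ index (suc k) y → x ≡ y
  injective vx vy = index-injective (s≤s z≤n) (onLegs⇒inSpider vx) (onLegs⇒inSpider vy)

-- P_{2k+1} + P_{k-1} as S_k without a neighbour of its centre

PP : ℕ → Graph
PP k = P (2 * k + 1) ⊕ P (k ∸ 1)

m∸n≡1+[m∸1+n] : ∀ {m n} → suc n ≤ m → m ∸ n ≡ suc (m ∸ suc n)
m∸n≡1+[m∸1+n] = +-∸-assoc 1

module PathPair (k′ : ℕ) where
  k N : ℕ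
  k = suc k′
  N = 2 * k + 1

  N≡1+k+k : N ≡ suc k + k
  N≡1+k+k = trans (+-comm (2 * k) 1) (cong (λ c → suc (k + c)) (+-identityʳ k))

  1+k+r<N : ∀ {r} → r < k → suc k + r < N
  1+k+r<N {r} r<k = subst (suc k + r <_) (sym N≡1+k+k) (+-monoʳ-< (suc k) r<k)

  k<N : k < N
  k<N = subst (k <_) (sym N≡1+k+k) (s≤s (m≤m+n k k))

  Vertex : Coord → Set
  Vertex = InSpider k ∩ (_≢ leg ℓ₂ 0)

  -- The long path runs down leg ℓ₀, through the centre and up leg ℓ₁; the short path is leg ℓ₂
  -- without its first vertex, whose position is junk.
  position : Coord → ℕ
  position centre           = k
  position (leg ℓ₀ r)       = k′ ∸ r
  position (leg ℓ₁ r)       = suc k + r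
  position (leg ℓ₂ zero)    = 0
  position (leg ℓ₂ (suc r)) = N + r

  next : Coord → Coord
  next centre           = leg ℓ₁ 0
  next (leg ℓ₀ zero)    = centre
  next (leg ℓ₀ (suc r)) = leg ℓ₀ r
  next (leg ℓ₁ r)       = leg ℓ₁ (suc r)
  next (leg ℓ₂ r)       = leg ℓ₂ (suc r)

  OnLongPath : Coord → Set
  OnLongPath centre     = ⊤
  OnLongPath (leg ℓ₀ _) = ⊤
  OnLongPath (leg ℓ₁ _) = ⊤
  OnLongPath (leg ℓ₂ _) = ⊥

  data Part : Coord → Set where
    long  : ∀ {x} → OnLongPath x → Part x
    short : ∀ r → Part (leg ℓ₂ (suc r))

  part : ∀ {x} → Vertex x → Part x
  part {centre}           _       = long tt
  part {leg ℓ₀ _}         _       = long tt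
  part {leg ℓ₁ _}         _       = long tt
  part {leg ℓ₂ zero}      (_ , ≢) = ⊥-elim (≢ refl)
  part {leg ℓ₂ (suc r)}   _       = short r

  short-vertex : ∀ {r} → r < k′ → Vertex (leg ℓ₂ (suc r))
  short-vertex r<k′ = s≤s r<k′ , λ ()

  next-long : ∀ {x} → OnLongPath x → OnLongPath (next x)
  next-long {centre}         _ = tt
  next-long {leg ℓ₀ zero}    _ = tt
  next-long {leg ℓ₀ (suc _)} _ = tt
  next-long {leg ℓ₁ _}       _ = tt
  next-long {leg ℓ₂ _}       ()

  position-next : ∀ {x} → Vertex x → position (next x) ≡ suc (position x)
  position-next {centre}         _        = +-identityʳ (suc k)
  position-next {leg ℓ₀ zero}    _        = refl
  position-next {leg ℓ₀ (suc r)} (r< , _) = m∸n≡1+[m∸1+n] (s<s⁻¹ r<)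
  position-next {leg ℓ₁ r}       _        = +-suc (suc k) r
  position-next {leg ℓ₂ zero}    (_ , ≢)  = ⊥-elim (≢ refl)
  position-next {leg ℓ₂ (suc r)} _        = +-suc N r

  position<N : ∀ {x} → Vertex x → OnLongPath x → position x < N
  position<N {centre}   _        _ = k<N
  position<N {leg ℓ₀ r} _        _ = ≤-trans (s≤s (m∸n≤m k′ r)) (<⇒≤ k<N)
  position<N {leg ℓ₁ r} (r<k , _) _ = 1+k+r<N r<k
  position<N {leg ℓ₂ _} _        ()

  next-vertex : ∀ {x} → Vertex x → suc (position x) < N → Vertex (next x)
  next-vertex {centre}         _        _ = s≤s z≤n , λ ()
  next-vertex {leg ℓ₀ zero}    _        _ = tt , λ ()
  next-vertex {leg ℓ₀ (suc r)} (r< , _) _ = <-trans (n<1+n r) r< , λ ()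
  next-vertex {leg ℓ₁ r}       _        l =
    +-cancelˡ-< (suc k) (suc r) k (subst₂ _<_ (sym (+-suc (suc k) r)) N≡1+k+k l) , λ ()
  next-vertex {leg ℓ₂ zero}    (_ , ≢)  _ = ⊥-elim (≢ refl)
  next-vertex {leg ℓ₂ (suc r)} _        l = ⊥-elim (m+n≮m N r (<-trans (n<1+n _) l))

  walk : ℕ → Coord
  walk zero    = leg ℓ₀ k′
  walk (suc a) = next (walk a)

  walk-vertex : ∀ {a} → a < N → Vertex (walk a) × position (walk a) ≡ a
  walk-vertex {zero}  _      = (≤-refl , λ ()) , n∸n≡0 k′
  walk-vertex {suc a} 1+a<N =
    let v , p = walk-vertex (<-trans (n<1+n a) 1+a<N)
    in next-vertex v (subst (λ c → suc c < N) (sym p) 1+a<N) , trans (position-next v) (cong suc p)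

  walk-ℓ₀ : ∀ {a} → a ≤ k′ → walk a ≡ leg ℓ₀ (k′ ∸ a)
  walk-ℓ₀ {zero}  _      = refl
  walk-ℓ₀ {suc a} 1+a≤k′ rewrite walk-ℓ₀ (<⇒≤ 1+a≤k′) | m∸n≡1+[m∸1+n] 1+a≤k′ = refl

  walk-centre : walk k ≡ centre
  walk-centre rewrite walk-ℓ₀ (≤-refl {k′}) | n∸n≡0 k′ = refl

  walk-ℓ₁ : ∀ r → walk (suc k + r) ≡ leg ℓ₁ r
  walk-ℓ₁ zero    = trans (cong walk (+-identityʳ (suc k))) (cong next walk-centre)
  walk-ℓ₁ (suc r) = trans (cong walk (+-suc (suc k) r)) (cong next (walk-ℓ₁ r))

  walk-position : ∀ {x} → Vertex x → OnLongPath x → walk (position x) ≡ x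
  walk-position {centre}   _        _ = walk-centre
  walk-position {leg ℓ₀ r} (r<k , _) _ =
    trans (walk-ℓ₀ (m∸n≤m k′ r)) (cong (leg ℓ₀) (m∸[m∸n]≡n (m<1+n⇒m≤n r<k)))
  walk-position {leg ℓ₁ r} _        _ = walk-ℓ₁ r
  walk-position {leg ℓ₂ _} _        ()

  position-injective : ∀ {x y} → Vertex x → Vertex y → position x ≡ position y → x ≡ y
  position-injective vx vy e with part vx | part vy
  ... | long lx | long ly = trans (sym (walk-position vx lx)) (trans (cong walk e) (walk-position vy ly))
  ... | long lx | short r = ⊥-elim (m+n≮m N r (subst (_< N) e (position<N vx lx)))
  ... | short r | long ly = ⊥-elim (m+n≮m N r (subst (_< N) (sym e) (position<N vy ly)))
  ... | short r | short r′ = cong (λ r → leg ℓ₂ (suc r)) (+-cancelˡ-≡ N r r′ e)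

  position< : ∀ {x} → Vertex x → position x < N + k′
  position< vx with part vx
  ... | long lx  = ≤-trans (position<N vx lx) (m≤m+n N k′)
  ... | short r  = +-monoʳ-< N (s<s⁻¹ (proj₁ vx))

  position-surjective : ∀ {a} → a < N + k′ → Σ Coord λ x → Vertex x × position x ≡ a
  position-surjective {a} a< with a <? N
  ... | yes a<N = walk a , walk-vertex a<N
  ... | no a≮N  = leg ℓ₂ (suc (a ∸ N)) , short-vertex a∸N<k′ , N+[a∸N]≡a
    where
    N+[a∸N]≡a : N + (a ∸ N) ≡ a
    N+[a∸N]≡a = m+[n∸m]≡n (≮⇒≥ a≮N)
    a∸N<k′ : a ∸ N < k′
    a∸N<k′ = +-cancelˡ-< N _ _ (subst (_< N + k′) (sym N+[a∸N]≡a) a<)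

  edge-next⇔ : ∀ {x y} → Vertex x → Vertex y → edge (PP k) (position x) (position y) ≡ true ⇔ y ≡ next x
  edge-next⇔ vx vy = mk⇔ (split vx vy) (join vx vy)
    where
    split : ∀ {x y} → Vertex x → Vertex y → edge (PP k) (position x) (position y) ≡ true → y ≡ next x
    split vx vy e with to (edge-⊕ {P N} {P k′}) e
    ... | inj₁ (_ , _ , e′) =
      let 1+x≡y , y<N = to edge-P e′
          vnx = next-vertex vx (subst (_< N) (sym 1+x≡y) y<N)
      in sym (position-injective vnx vy (trans (position-next vx) 1+x≡y))
    ... | inj₂ (a′ , b′ , ex , ey , e′) with to (edge-P {k′} {a′}) e′
    ...   | refl , b′<k′
      with position-injective vx (short-vertex (<-trans (n<1+n a′) b′<k′)) ex
         | position-injective vy (short-vertex b′<k′) ey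
    ...   | refl | refl = refl
    join : ∀ {x y} → Vertex x → Vertex y → y ≡ next x → edge (PP k) (position x) (position y) ≡ true
    join vx vy refl with part vx
    ... | long lx = from (edge-⊕ {P N} {P k′})
      (inj₁ (position<N vx lx , y<N , from edge-P (sym (position-next vx) , y<N)))
      where
      y<N = position<N vy (next-long lx)
    ... | short r = from (edge-⊕ {P N} {P k′})
      (inj₂ (r , suc r , refl , refl , from edge-P (refl , s<s⁻¹ (proj₁ vy))))

  Next : Coord → Coord → Set
  Next x y = y ≡ next x

  Next-irreflexive : ∀ {x} → ¬ Next x x
  Next-irreflexive {centre}         ()
  Next-irreflexive {leg ℓ₀ zero}    ()
  Next-irreflexive {leg ℓ₀ (suc r)} ()
  Next-irreflexive {leg ℓ₁ r}       ()
  Next-irreflexive {leg ℓ₂ r}       ()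

  AdjS-next : ∀ x → AdjS x (next x)
  AdjS-next centre           = bwd (inj₂ (hub ℓ₁))
  AdjS-next (leg ℓ₀ zero)    = fwd (inj₂ (hub ℓ₀))
  AdjS-next (leg ℓ₀ (suc r)) = bwd (inj₁ (step ℓ₀ r))
  AdjS-next (leg ℓ₁ r)       = fwd (inj₁ (step ℓ₁ r))
  AdjS-next (leg ℓ₂ r)       = fwd (inj₁ (step ℓ₂ r))

  ArcS⇒Next : ∀ {x y} → x ≢ leg ℓ₂ 0 → ArcS x y → SymClosure Next x y
  ArcS⇒Next _ (inj₁ (step ℓ₀ r)) = bwd refl
  ArcS⇒Next _ (inj₁ (step ℓ₁ r)) = fwd refl
  ArcS⇒Next _ (inj₁ (step ℓ₂ r)) = fwd refl
  ArcS⇒Next _ (inj₂ (hub ℓ₀))    = fwd refl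
  ArcS⇒Next _ (inj₂ (hub ℓ₁))    = bwd refl
  ArcS⇒Next ≢ (inj₂ (hub ℓ₂))    = ⊥-elim (≢ refl)

  Next⇔AdjS : ∀ {x y} → Vertex x → Vertex y → SymClosure Next x y ⇔ AdjS x y
  Next⇔AdjS {x} {y} (_ , x≢) (_ , y≢) = mk⇔ split join
    where
    split : ∀ {x y} → SymClosure Next x y → AdjS x y
    split {x}     (fwd refl) = AdjS-next x
    split {y = y} (bwd refl) = symmetric ArcS (AdjS-next y)
    join : AdjS x y → SymClosure Next x y
    join (fwd a) = ArcS⇒Next x≢ a
    join (bwd a) = symmetric Next (ArcS⇒Next y≢ a)

  model : Model (PP k)
  model = record
    { Vertex = Vertex ; Adjacent = AdjS ; position = position
    ; position<           = position<
    ; position-injective  = position-injective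
    ; position-surjective = position-surjective
    ; adjacent⇔ = λ vx vy → ⇔-trans
        (adjacency-from-arcs {PP k} {pos = position} position-injective Next-irreflexive
          (λ vx vy _ → edge-next⇔ vx vy) vx vy)
        (Next⇔AdjS vx vy)
    }

relabel : (Fin 3 → Fin 3) → Coord → Coord
relabel π centre    = centre
relabel π (leg ℓ r) = leg (π ℓ) r

relabel-inSpider : ∀ {m} π x → InSpider m x → InSpider m (relabel π x)
relabel-inSpider π centre    v = v
relabel-inSpider π (leg ℓ r) v = v

relabel-inverse : ∀ {π π′ : Fin 3 → Fin 3} → (∀ ℓ → π′ (π ℓ) ≡ ℓ) → ∀ x → relabel π′ (relabel π x) ≡ x
relabel-inverse inv centre    = refl
relabel-inverse inv (leg ℓ r) = cong (λ ℓ → leg ℓ r) (inv ℓ)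

relabel-AdjS : ∀ π {x y} → AdjS x y → AdjS (relabel π x) (relabel π y)
relabel-AdjS π = gmap (relabel π) arc
  where
  arc : ∀ {x y} → ArcS x y → ArcS (relabel π x) (relabel π y)
  arc (inj₁ (step ℓ r)) = inj₁ (step (π ℓ) r)
  arc (inj₂ (hub ℓ))    = inj₂ (hub (π ℓ))

moveMissingLeg : ∀ {H k} ℓ →
  CoordEmbedding H (InSpider k ∩ (_≢ leg ℓ 0)) AdjS → CoordEmbedding H (InSpider k ∩ (_≢ leg ℓ₂ 0)) AdjS
moveMissingLeg ℓ = remap (relabel π)
  (λ {x} (vx , x≢) → relabel-inSpider π x vx , λ e → x≢ (trans (sym (inv x)) (cong (relabel π′) e)))
  (λ {x} {y} _ _ e → trans (sym (inv x)) (trans (cong (relabel π′) e) (inv y)))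
  (λ {x} {y} _ _ → mk⇔ (relabel-AdjS π) (λ a → subst₂ AdjS (inv x) (inv y) (relabel-AdjS π′ a)))
  where
  π π′ : Fin 3 → Fin 3
  π  = transpose ℓ ℓ₂
  π′ = transpose ℓ₂ ℓ
  inv : ∀ x → relabel π′ (relabel π x) ≡ x
  inv = relabel-inverse (λ _ → transpose-inverse ℓ₂ ℓ)

3P⇒S : ∀ {H k} → CoordEmbedding H (OnLegs k) AdjS → CoordEmbedding H (InSpider k) AdjS
3P⇒S = relax onLegs⇒inSpider

PP⇒S : ∀ {H k} → CoordEmbedding H (InSpider k ∩ (_≢ leg ℓ₂ 0)) AdjS → CoordEmbedding H (InSpider k) AdjS
PP⇒S = relax proj₁

outward : Coord → Coord
outward centre    = centre
outward (leg ℓ r) = leg ℓ (suc r)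

outward-AdjS⇔AdjT : ∀ {m x y} → OnLegs m x → OnLegs m y → AdjS x y ⇔ AdjT (outward x) (outward y)
outward-AdjS⇔AdjT {x = leg _ _} {leg _ _} _ _ = mk⇔ push pull
  where
  push : ∀ {ℓ r ℓ′ r′} → AdjS (leg ℓ r) (leg ℓ′ r′) → AdjT (leg ℓ (suc r)) (leg ℓ′ (suc r′))
  push (fwd (inj₁ (step ℓ r))) = fwd (inj₁ (step ℓ (suc r)))
  push (bwd (inj₁ (step ℓ r))) = bwd (inj₁ (step ℓ (suc r)))
  pull : ∀ {ℓ r ℓ′ r′} → AdjT (leg ℓ (suc r)) (leg ℓ′ (suc r′)) → AdjS (leg ℓ r) (leg ℓ′ r′)
  pull (fwd (inj₁ (step ℓ (suc r)))) = fwd (inj₁ (step ℓ r))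
  pull (bwd (inj₁ (step ℓ (suc r)))) = bwd (inj₁ (step ℓ r))

3P⇒T : ∀ {H k} → CoordEmbedding H (OnLegs k) AdjS → CoordEmbedding H (OnLegs (suc k)) AdjT
3P⇒T = remap outward valid injective outward-AdjS⇔AdjT
  where
  valid : ∀ {k x} → OnLegs k x → OnLegs (suc k) (outward x)
  valid {x = leg _ _} r<k = s≤s r<k
  injective : ∀ {k x y} → OnLegs k x → OnLegs k y → outward x ≡ outward y → x ≡ y
  injective {x = leg _ _} {leg _ _} _ _ refl = refl

pushLeg₀ : Coord → Coord
pushLeg₀ centre    = leg ℓ₀ 0
pushLeg₀ (leg ℓ₀ r) = leg ℓ₀ (suc r)
pushLeg₀ (leg ℓ₁ r) = leg ℓ₁ r
pushLeg₀ (leg ℓ₂ r) = leg ℓ₂ r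

pullLeg₀ : Coord → Coord
pullLeg₀ centre           = centre
pullLeg₀ (leg ℓ₀ zero)    = centre
pullLeg₀ (leg ℓ₀ (suc r)) = leg ℓ₀ r
pullLeg₀ (leg ℓ₁ r)       = leg ℓ₁ r
pullLeg₀ (leg ℓ₂ r)       = leg ℓ₂ r

pull-push : ∀ x → pullLeg₀ (pushLeg₀ x) ≡ x
pull-push centre     = refl
pull-push (leg ℓ₀ r) = refl
pull-push (leg ℓ₁ r) = refl
pull-push (leg ℓ₂ r) = refl

push≢ℓ₂ : ∀ {x} → x ≢ leg ℓ₂ 0 → pushLeg₀ x ≢ leg ℓ₂ 0
push≢ℓ₂ {centre}     _ ()
push≢ℓ₂ {leg ℓ₀ _}   _ ()
push≢ℓ₂ {leg ℓ₁ _}   _ ()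
push≢ℓ₂ {leg ℓ₂ r}   x≢ e = x≢ e

ArcS⇒AdjT-push : ∀ {x y} → x ≢ leg ℓ₂ 0 → ArcS x y → AdjT (pushLeg₀ x) (pushLeg₀ y)
ArcS⇒AdjT-push _  (inj₁ (step ℓ₀ r)) = fwd (inj₁ (step ℓ₀ (suc r)))
ArcS⇒AdjT-push _  (inj₁ (step ℓ₁ r)) = fwd (inj₁ (step ℓ₁ r))
ArcS⇒AdjT-push _  (inj₁ (step ℓ₂ r)) = fwd (inj₁ (step ℓ₂ r))
ArcS⇒AdjT-push _  (inj₂ (hub ℓ₀))    = bwd (inj₁ (step ℓ₀ 0))
ArcS⇒AdjT-push _  (inj₂ (hub ℓ₁))    = fwd (inj₂ (triangle λ ()))
ArcS⇒AdjT-push x≢ (inj₂ (hub ℓ₂))    = ⊥-elim (x≢ refl)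

ArcT⇒AdjS-pull : ∀ {u v} → u ≢ leg ℓ₂ 0 → v ≢ leg ℓ₂ 0 → ArcT u v → AdjS (pullLeg₀ u) (pullLeg₀ v)
ArcT⇒AdjS-pull _ _ (inj₁ (step ℓ₀ zero))    = bwd (inj₂ (hub ℓ₀))
ArcT⇒AdjS-pull _ _ (inj₁ (step ℓ₀ (suc r))) = fwd (inj₁ (step ℓ₀ r))
ArcT⇒AdjS-pull _ _ (inj₁ (step ℓ₁ r))       = fwd (inj₁ (step ℓ₁ r))
ArcT⇒AdjS-pull _ _ (inj₁ (step ℓ₂ r))       = fwd (inj₁ (step ℓ₂ r))
ArcT⇒AdjS-pull _ _ (inj₂ (triangle {ℓ₀} {ℓ₁} _)) = bwd (inj₂ (hub ℓ₁))
ArcT⇒AdjS-pull _ _ (inj₂ (triangle {ℓ₁} {ℓ₀} _)) = fwd (inj₂ (hub ℓ₁))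
ArcT⇒AdjS-pull _ _ (inj₂ (triangle {ℓ₀} {ℓ₀} ℓ≢ℓ)) = ⊥-elim (ℓ≢ℓ refl)
ArcT⇒AdjS-pull _ _ (inj₂ (triangle {ℓ₁} {ℓ₁} ℓ≢ℓ)) = ⊥-elim (ℓ≢ℓ refl)
ArcT⇒AdjS-pull u≢ _ (inj₂ (triangle {ℓ₂} _)) = ⊥-elim (u≢ refl)
ArcT⇒AdjS-pull _ v≢ (inj₂ (triangle {ℓ′ = ℓ₂} _)) = ⊥-elim (v≢ refl)

PP⇒T : ∀ {H k} → CoordEmbedding H (InSpider k ∩ (_≢ leg ℓ₂ 0)) AdjS → CoordEmbedding H (OnLegs (suc k)) AdjT
PP⇒T = remap pushLeg₀ valid
  (λ {x} {y} _ _ e → trans (sym (pull-push x)) (trans (cong pullLeg₀ e) (pull-push y)))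
  (λ vx vy → mk⇔ (push vx vy) (pull vx vy))
  where
  valid : ∀ {k x} → (InSpider k ∩ (_≢ leg ℓ₂ 0)) x → OnLegs (suc k) (pushLeg₀ x)
  valid {x = centre}     _         = s≤s z≤n
  valid {x = leg ℓ₀ _}   (r<k , _) = s≤s r<k
  valid {x = leg ℓ₁ _}   (r<k , _) = <-trans r<k (n<1+n _)
  valid {x = leg ℓ₂ _}   (r<k , _) = <-trans r<k (n<1+n _)
  push : ∀ {k x y} → (InSpider k ∩ (_≢ leg ℓ₂ 0)) x → (InSpider k ∩ (_≢ leg ℓ₂ 0)) y →
    AdjS x y → AdjT (pushLeg₀ x) (pushLeg₀ y)
  push (_ , x≢) _ (fwd a) = ArcS⇒AdjT-push x≢ a
  push _ (_ , y≢) (bwd a) = symmetric ArcT (ArcS⇒AdjT-push y≢ a)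
  pull : ∀ {k x y} → (InSpider k ∩ (_≢ leg ℓ₂ 0)) x → (InSpider k ∩ (_≢ leg ℓ₂ 0)) y →
    AdjT (pushLeg₀ x) (pushLeg₀ y) → AdjS x y
  pull {x = x} {y} (_ , x≢) (_ , y≢) a = subst₂ AdjS (pull-push x) (pull-push y) (pulled a)
    where
    pulled : AdjT (pushLeg₀ x) (pushLeg₀ y) → AdjS (pullLeg₀ (pushLeg₀ x)) (pullLeg₀ (pushLeg₀ y))
    pulled (fwd a) = ArcT⇒AdjS-pull (push≢ℓ₂ x≢) (push≢ℓ₂ y≢) a
    pulled (bwd a) = symmetric ArcS (ArcT⇒AdjS-pull (push≢ℓ₂ y≢) (push≢ℓ₂ x≢) a)

-- Claws

record Claw {A : Set} (R : A → A → Set) (x a b c : A) : Set where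
  field
    xa  : R x a
    xb  : R x b
    xc  : R x c
    a≢b : a ≢ b
    a≢c : a ≢ c
    b≢c : b ≢ c
    ¬ab : ¬ R a b
    ¬ac : ¬ R a c
    ¬bc : ¬ R b c

module _ {A B : Set} {R : A → A → Set} {R′ : B → B → Set} (f : A → B)
         (f-adj⇔ : ∀ {x y} → R x y ⇔ R′ (f x) (f y)) where

  Claw-pull : ∀ {x a b c x′ a′ b′ c′} → f x ≡ x′ → f a ≡ a′ → f b ≡ b′ → f c ≡ c′ →
    Claw R′ x′ a′ b′ c′ → Claw R x a b c
  Claw-pull refl refl refl refl claw = record
    { xa  = from f-adj⇔ xa ; xb = from f-adj⇔ xb ; xc = from f-adj⇔ xc
    ; a≢b = λ e → a≢b (cong f e) ; a≢c = λ e → a≢c (cong f e) ; b≢c = λ e → b≢c (cong f e)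
    ; ¬ab = λ r → ¬ab (to f-adj⇔ r) ; ¬ac = λ r → ¬ac (to f-adj⇔ r) ; ¬bc = λ r → ¬bc (to f-adj⇔ r)
    }
    where open Claw claw

  Claw-push : (∀ {x y} → f x ≡ f y → x ≡ y) → ∀ {x a b c} →
    Claw R x a b c → Claw R′ (f x) (f a) (f b) (f c)
  Claw-push f-injective claw = record
    { xa  = to f-adj⇔ xa ; xb = to f-adj⇔ xb ; xc = to f-adj⇔ xc
    ; a≢b = λ e → a≢b (f-injective e) ; a≢c = λ e → a≢c (f-injective e)
    ; b≢c = λ e → b≢c (f-injective e)
    ; ¬ab = λ r → ¬ab (from f-adj⇔ r) ; ¬ac = λ r → ¬ac (from f-adj⇔ r) ; ¬bc = λ r → ¬bc (from f-adj⇔ r)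
    }
    where open Claw claw

centre-claw : Claw AdjS centre (leg ℓ₀ 0) (leg ℓ₁ 0) (leg ℓ₂ 0)
centre-claw = record
  { xa = bwd (inj₂ (hub ℓ₀)) ; xb = bwd (inj₂ (hub ℓ₁)) ; xc = bwd (inj₂ (hub ℓ₂))
  ; a≢b = λ () ; a≢c = λ () ; b≢c = λ ()
  ; ¬ab = legStarts-nonadjacent ; ¬ac = legStarts-nonadjacent ; ¬bc = legStarts-nonadjacent
  }
  where
  legStarts-nonadjacent : ∀ {ℓ ℓ′} → ¬ AdjS (leg ℓ 0) (leg ℓ′ 0)
  legStarts-nonadjacent (fwd (inj₁ ()))
  legStarts-nonadjacent (fwd (inj₂ ()))
  legStarts-nonadjacent (bwd (inj₁ ()))
  legStarts-nonadjacent (bwd (inj₂ ()))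

data TNeighbour : Coord → Coord → Set where
  outwards : ∀ ℓ r → TNeighbour (leg ℓ r) (leg ℓ (suc r))
  inwards  : ∀ ℓ r → TNeighbour (leg ℓ (suc r)) (leg ℓ r)
  across   : ∀ {ℓ ℓ′} → ℓ ≢ ℓ′ → TNeighbour (leg ℓ 0) (leg ℓ′ 0)

AdjT⇒TNeighbour : ∀ {x a} → AdjT x a → TNeighbour x a
AdjT⇒TNeighbour (fwd (inj₁ (step ℓ r)))    = outwards ℓ r
AdjT⇒TNeighbour (fwd (inj₂ (triangle ≢)))  = across ≢
AdjT⇒TNeighbour (bwd (inj₁ (step ℓ r)))    = inwards ℓ r
AdjT⇒TNeighbour (bwd (inj₂ (triangle ≢)))  = across (λ e → ≢ (sym e))

nonadjacent-neighbours : ∀ {x a b} → TNeighbour x a → TNeighbour x b → a ≢ b → ¬ AdjT a b →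
  a ≡ outward x ⊎ b ≡ outward x
nonadjacent-neighbours (outwards _ _) _ _ _ = inj₁ refl
nonadjacent-neighbours _ (outwards _ _) _ _ = inj₂ refl
nonadjacent-neighbours (inwards _ _) (inwards _ _) a≢b _ = ⊥-elim (a≢b refl)
nonadjacent-neighbours (across {ℓ′ = ℓ′} _) (across {ℓ′ = ℓ″} _) a≢b ¬ab with ℓ′ ≟ᶠ ℓ″
... | yes refl   = ⊥-elim (a≢b refl)
... | no ℓ′≢ℓ″  = ⊥-elim (¬ab (fwd (inj₂ (triangle ℓ′≢ℓ″))))

AdjT-clawFree : ∀ {x a b c} → ¬ Claw AdjT x a b c
AdjT-clawFree {x} {a} {b} {c} claw =
  pigeonhole (nonadjacent-neighbours na nb a≢b ¬ab) (nonadjacent-neighbours na nc a≢c ¬ac)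
             (nonadjacent-neighbours nb nc b≢c ¬bc)
  where
  open Claw claw
  na = AdjT⇒TNeighbour xa
  nb = AdjT⇒TNeighbour xb
  nc = AdjT⇒TNeighbour xc
  pigeonhole : a ≡ outward x ⊎ b ≡ outward x → a ≡ outward x ⊎ c ≡ outward x →
    b ≡ outward x ⊎ c ≡ outward x → ⊥
  pigeonhole (inj₁ a≡) _         (inj₁ b≡) = a≢b (trans a≡ (sym b≡))
  pigeonhole (inj₁ a≡) _         (inj₂ c≡) = a≢c (trans a≡ (sym c≡))
  pigeonhole (inj₂ b≡) (inj₁ a≡) _         = a≢b (trans a≡ (sym b≡))
  pigeonhole (inj₂ b≡) (inj₂ c≡) _         = b≢c (trans b≡ (sym c≡))

module _ {H : Graph} {k′ : ℕ} (eS : CoordEmbedding H (InSpider (suc k′)) AdjS)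
         (eT : CoordEmbedding H (OnLegs (suc (suc k′))) AdjT) where
  open CoordEmbedding eS using (coord)

  Hit : Coord → Set
  Hit x = Σ (Fin (n H)) λ i → coord i ≡ x

  hit? : ∀ x → Dec (Hit x)
  hit? x = any? (λ i → coord i ≟ᶜ x)

  avoiding : ∀ x → ¬ Hit x → CoordEmbedding H (InSpider (suc k′) ∩ (_≢ x)) AdjS
  avoiding x ¬hit = restrict eS (λ i e → ¬hit (i , e))

  ¬centreClaw : Hit centre → ¬ (∀ ℓ → Hit (leg ℓ 0))
  ¬centreClaw (i , eᵢ) hits =
    let j₀ , e₀ = hits ℓ₀ ; j₁ , e₁ = hits ℓ₁ ; j₂ , e₂ = hits ℓ₂ in
    AdjT-clawFree (Claw-push coordT (λ {i j} → adj⇔T i j) coordT-injective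
      (Claw-pull coordS (λ {i j} → adj⇔S i j) eᵢ e₀ e₁ e₂ centre-claw))
    where
    open CoordEmbedding eS renaming (coord to coordS; adj⇔ to adj⇔S) using ()
    open CoordEmbedding eT renaming (coord to coordT; adj⇔ to adj⇔T; coord-injective to coordT-injective) using ()

  S∩T⇒3P⊎PP : H ⊑ 3P (suc k′) ⊎ H ⊑ PP (suc k′)
  S∩T⇒3P⊎PP with hit? centre
  ... | no ¬hit = inj₁ (coordEmbedding⇒⊑ (model3P (suc k′) (s≤s z≤n)) (relax onLegs (avoiding centre ¬hit)))
    where
    onLegs : ∀ {x} → (InSpider (suc k′) ∩ (_≢ centre)) x → OnLegs (suc k′) x
    onLegs {centre}  (_ , ≢) = ≢ refl
    onLegs {leg _ _} (v , _) = v
  ... | yes centreHit with all? (λ ℓ → hit? (leg ℓ 0))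
  ...   | yes legsHit = ⊥-elim (¬centreClaw centreHit legsHit)
  ...   | no ¬legsHit =
    let ℓ , ¬hit = ¬∀⟶∃¬ 3 _ (λ ℓ → hit? (leg ℓ 0)) ¬legsHit
    in inj₂ (coordEmbedding⇒⊑ (PathPair.model k′) (moveMissingLeg ℓ (avoiding (leg ℓ 0) ¬hit)))

lemma12 : (k : ℕ) → 1 ≤ k → (H : Graph) →
    ((H ⊑ S k) × (H ⊑ T k)) ⇔ ((H ⊑ 3P k) ⊎ (H ⊑ (P (2 * k + 1) ⊕ P (k ∸ 1))))
lemma12 zero () _
lemma12 (suc k′) _ H = mk⇔ forward backward
  where
  k = suc k′
  M3 = model3P k (s≤s z≤n)
  MS = modelS k (s≤s z≤n)
  MT = modelT k
  MPP = PathPair.model k′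

  forward : (H ⊑ S k) × (H ⊑ T k) → H ⊑ 3P k ⊎ H ⊑ PP k
  forward (fS , fT) = S∩T⇒3P⊎PP (⊑⇒coordEmbedding MS {H} fS) (⊑⇒coordEmbedding MT {H} fT)

  backward : H ⊑ 3P k ⊎ H ⊑ PP k → (H ⊑ S k) × (H ⊑ T k)
  backward (inj₁ f) = let e = ⊑⇒coordEmbedding M3 {H} f in
    coordEmbedding⇒⊑ MS {H} (3P⇒S e) , coordEmbedding⇒⊑ MT {H} (3P⇒T e)
  backward (inj₂ f) = let e = ⊑⇒coordEmbedding MPP {H} f in
    coordEmbedding⇒⊑ MS {H} (PP⇒S e) , coordEmbedding⇒⊑ MT {H} (PP⇒T e)
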